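{- Let $A\subseteq V$ and let $U\subseteq A$ satisfy $\partial_{G[A]}U\le1.01\tilde\lambda$ and $\mathrm{vol}^W(U)\le s_0$. There exist an integer $k$ and a partition $U_1,\dots,U_k$ of $U$ such that: (1) for each $i\in[k]$, the minimum cut of $G[U_i]$ is at least $0.1\tilde\lambda$; (2) for at least $k/2-5$ indices $i\in[k]$, $\partial_{G[A]}U_i\le 0.4\tilde\lambda$; (3) the total weight $w(U_1,\dots,U_k)$ of edges between distinct parts is at most $0.1(k-1)\tilde\lambda$. More generally, for any $A'\subseteq A$, letting $I\subseteq[k]$ be the set of indices $i$ with $U_i\cap A'\ne\emptyset$: (2') for at least $|I|/2-5$ indices $i\in I$, $\partial_{G[A']}(U_i\cap A')\le 0.4\tilde\lambda$.
   Context: $G=(V,E,w)$ is an undirected graph with positive edge weights, $n=|V|$, minimum cut value $\lambda$, and $\tilde\lambda\le1.01\lambda$ a known positive value. $w(X,Y)$ is the total weight of edges between disjoint $X,Y$; $w(X_1,\dots,X_k)$ is the total weight of edges between distinct sets of a partition; $\mathrm{vol}^W(X)$ is the sum of weighted degrees in $G$; for $Y\subseteq B\subseteq V$, $\partial_{G[B]}Y=w(Y,B\setminus Y)$. $s_0=10^{11}\tilde\delta\tau^2$ with $\tilde\delta=\tilde\lambda/1.01$ and $\tau=\Theta(\log^{c/2}n)$, $c\ge2$ constant.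
   Formalization: The edge weights and the value $\tilde\lambda$ are rational, and τ ranges over all positive rationals. -}

module Defs where

open import Data.Nat as ℕ using (ℕ; zero; suc)
open import Data.Bool using (Bool; true; false; _∧_; if_then_else_)
open import Data.Fin using (Fin; zero; suc; toℕ)
open import Data.Fin.Subset as Sub using (Subset; _─_; _∩_; _⊆_; Nonempty)
open import Data.Vec using (lookup)
open import Data.Integer using (+_)
open import Data.Rational using (ℚ; 0ℚ; _+_; _*_; _≤_; _<_; _/_)
open import Data.Product using (Σ; _×_; ∃)
open import Relation.Binary.PropositionalEquality using (_≡_)
open import Relation.Nullary using (¬_)

Σℚ : (n : ℕ) → (Fin n → ℚ) → ℚ
Σℚ zero    f = 0ℚ
Σℚ (suc n) f = f zero + Σℚ n (λ i → f (suc i))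

-- a weighted undirected graph on vertex set Fin n: w i j is the weight of
-- edge {i,j} (0 = no edge); symmetric, nonnegative, no self-loops
record WGraph (n : ℕ) : Set where
  field
    w        : Fin n → Fin n → ℚ
    symm     : ∀ i j → w i j ≡ w j i
    nonneg   : ∀ i j → 0ℚ ≤ w i j
    noLoops  : ∀ i → w i i ≡ 0ℚ
open WGraph public

wBetween : ∀ {n} → WGraph n → Subset n → Subset n → ℚ
wBetween {n} G X Y =
  Σℚ n (λ i → Σℚ n (λ j → if lookup X i ∧ lookup Y j then w G i j else 0ℚ))

boundaryIn : ∀ {n} → WGraph n → Subset n → Subset n → ℚ
boundaryIn G B Y = wBetween G Y (B ─ Y)

vol : ∀ {n} → WGraph n → Subset n → ℚ
vol {n} G X = Σℚ n (λ i → if lookup X i then Σℚ n (λ j → w G i j) else 0ℚ)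

-- "the minimum cut of G[B] is at least c": every cut (Y, B∖Y) of G[B] with
-- both sides nonempty has weight ≥ c (vacuous if |B| < 2, min cut = ∞)
MinCutAtLeast : ∀ {n} → WGraph n → Subset n → ℚ → Set
MinCutAtLeast G B c =
  ∀ Y → Y ⊆ B → Nonempty Y → Nonempty (B ─ Y) → c ≤ boundaryIn G B Y

IsPartition : ∀ {n k} → Subset n → (Fin k → Subset n) → Set
IsPartition {n} {k} U P =
  (∀ i → Nonempty (P i)) ×
  (∀ i j → ¬ (i ≡ j) → ∀ (v : Fin n) → Sub._∈_ v (P i) → ¬ (Sub._∈_ v (P j))) ×
  (∀ i → P i ⊆ U) ×
  (∀ (v : Fin n) → Sub._∈_ v U → ∃ λ i → Sub._∈_ v (P i))

wParts : ∀ {n k} → WGraph n → (Fin k → Subset n) → ℚ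
wParts {n} {k} G P =
  Σℚ k (λ i → Σℚ k (λ j → if toℕ i ℕ.<ᵇ toℕ j then wBetween G (P i) (P j) else 0ℚ))

ℕtoℚ : ℕ → ℚ
ℕtoℚ m = + m / 1

c1·01 c0·1 c0·4 c1/1·01 c1/2 : ℚ
c1·01 = + 101 / 100
c0·1  = + 1 / 10
c0·4  = + 4 / 10
c1/1·01 = + 100 / 101
c1/2  = + 1 / 2

-- s₀ = 10^11 · δ̃ · τ² with δ̃ = λ̃/1.01
s₀ : ℚ → ℚ → ℚ
s₀ λ̃ τ = ℕtoℚ (100000000000) * (λ̃ * c1/1·01) * (τ * τ)

-- Split U recursively: while some part X has a cut (Y, X ∖ Y) of weight < λ̃/10, replace X by Y and X ∖ Y.
-- The parts that remain have min cut ≥ λ̃/10, and every split adds one part and less than λ̃/10 of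
-- crossing weight, which gives (3).
-- For A′ ⊆ A write ∂′X = ∂_{G[A′]}(X ∩ A′). Splitting X into Y and Z gives ∂′Y + ∂′Z = ∂′X + 2 w(Y ∩ A′, Z ∩ A′),
-- and the last term vanishes unless both traces are nonempty, so Σᵢ ∂′Uᵢ ≤ ∂_{G[A]}U + 0.2 λ̃ (|I| − 1).
-- With ∂_{G[A]}U ≤ 1.01 λ̃, Markov's inequality leaves at most |I|/2 + 2.53 indices of I with ∂′Uᵢ > 0.4 λ̃,
-- which gives (2′); (2) is the case A′ = A.

module Submission where

open import Defs
open import Data.Nat using (ℕ; _∸_)
open import Data.Fin using (Fin)
open import Data.Fin.Subset using (Subset; _⊆_; _∩_; _∈_; Nonempty; ∣_∣; ⊤)
open import Data.Rational using (ℚ; 0ℚ; _<_; _≤_; _+_; _-_; _*_)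
open import Data.Product using (Σ; _×_; ∃; ∃-syntax)
open import Function.Bundles using (_⇔_)

open import Algebra.Bundles using (CommutativeRing)
import Algebra.Properties.Semiring.Sum as SemiringSum
open import Data.Bool using (Bool; true; false; _∧_; not; if_then_else_)
import Data.Bool.Properties as BoolP
open import Data.Empty using (⊥-elim)
open import Data.Fin using (zero; suc; toℕ; _↑ˡ_; _↑ʳ_; splitAt)
import Data.Fin.Properties as FinP
open import Data.Fin.Subset using (_∪_; _─_; _∉_)
open import Data.Fin.Subset.Properties
  using (nonempty?; anySubset?; _⊆?_; _∈?_; ⊆-antisym; ∈⊤; ∣⊤∣≡n; p─q⊆p; p∩q⊆p; p∩q⊆q; p⊂q⇒∣p∣<∣q∣;
         x∈p∩q⁻; x∈p∩q⁺; x∈p∪q⁻; x∈p∪q⁺; x∈p∧x∉q⇒x∈p─q)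
import Data.Integer as ℤ
import Data.Integer.Properties as ℤP
open import Data.Nat as ℕ using (zero; suc; _<ᵇ_)
import Data.Nat.Coprimality as Coprime
open import Data.Nat.Induction using (<-wellFounded)
import Data.Nat.Properties as ℕP
open import Data.Product using (_,_; proj₁; proj₂)
import Data.Rational as ℚ
open import Data.Rational using (1ℚ; mkℚ; toℚᵘ; positive; nonNegative)
import Data.Rational.Properties as ℚP
open import Data.Rational.Solver using (module +-*-Solver)
import Data.Rational.Unnormalised as ℚᵘ
import Data.Rational.Unnormalised.Properties as ℚᵘP
open import Data.Sum using (inj₁; inj₂)
open import Data.Vec using ([]; _∷_; lookup; tabulate; there)
open import Data.Vec.Properties using (lookup-zipWith; lookup∘tabulate; []=⇒lookup; lookup⇒[]=)
open import Data.Vec.Functional using (_++_)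
open import Data.Vec.Functional.Properties using (lookup-++ˡ; lookup-++ʳ)
open import Function using (_∘_; id)
open import Function.Bundles using (mk⇔; Equivalence)
open import Induction.WellFounded using (Acc; acc)
open import Relation.Binary.PropositionalEquality
open import Relation.Nullary using (¬_; Dec; yes; no; does)
open import Relation.Nullary.Decidable using (dec-true; dec-false; from-yes; _×-dec_)
open import Relation.Nullary.Negation using (contradiction)

open +-*-Solver

private module ∑ = SemiringSum (CommutativeRing.semiring ℚP.+-*-commutativeRing)

Σℚ≡sum : ∀ k (f : Fin k → ℚ) → Σℚ k f ≡ ∑.sum f
Σℚ≡sum zero    f = refl
Σℚ≡sum (suc k) f = cong (f zero +_) (Σℚ≡sum k (f ∘ suc))

Σℚ-cong : ∀ k {f g : Fin k → ℚ} → (∀ i → f i ≡ g i) → Σℚ k f ≡ Σℚ k g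
Σℚ-cong zero    f≗g = refl
Σℚ-cong (suc k) f≗g = cong₂ _+_ (f≗g zero) (Σℚ-cong k (f≗g ∘ suc))

Σℚ-zero : ∀ k → Σℚ k (λ _ → 0ℚ) ≡ 0ℚ
Σℚ-zero k = trans (Σℚ≡sum k _) (∑.sum-replicate-zero k)

Σℚ-+ : ∀ k (f g : Fin k → ℚ) → Σℚ k (λ i → f i + g i) ≡ Σℚ k f + Σℚ k g
Σℚ-+ k f g = begin
  Σℚ k (λ i → f i + g i)  ≡⟨ Σℚ≡sum k _ ⟩
  ∑.sum (λ i → f i + g i)  ≡⟨ ∑.∑-distrib-+ f g ⟩
  ∑.sum f + ∑.sum g        ≡⟨ sym (cong₂ _+_ (Σℚ≡sum k f) (Σℚ≡sum k g)) ⟩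
  Σℚ k f + Σℚ k g          ∎
  where open ≡-Reasoning

Σℚ-*ˡ : ∀ k a (f : Fin k → ℚ) → Σℚ k (λ i → a * f i) ≡ a * Σℚ k f
Σℚ-*ˡ k a f = begin
  Σℚ k (λ i → a * f i)  ≡⟨ Σℚ≡sum k _ ⟩
  ∑.sum (λ i → a * f i)  ≡⟨ ∑.*-distribˡ-sum a f ⟨
  a * ∑.sum f            ≡⟨ cong (a *_) (Σℚ≡sum k f) ⟨
  a * Σℚ k f             ∎
  where open ≡-Reasoning

Σℚ-*ʳ : ∀ k a (f : Fin k → ℚ) → Σℚ k (λ i → f i * a) ≡ Σℚ k f * a
Σℚ-*ʳ k a f = begin
  Σℚ k (λ i → f i * a)  ≡⟨ Σℚ-cong k (λ i → ℚP.*-comm (f i) a) ⟩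
  Σℚ k (λ i → a * f i)  ≡⟨ Σℚ-*ˡ k a f ⟩
  a * Σℚ k f            ≡⟨ ℚP.*-comm a _ ⟩
  Σℚ k f * a            ∎
  where open ≡-Reasoning

Σℚ-comm : ∀ k m (f : Fin k → Fin m → ℚ) →
          Σℚ k (λ i → Σℚ m (f i)) ≡ Σℚ m (λ j → Σℚ k (λ i → f i j))
Σℚ-comm k m f = begin
  Σℚ k (λ i → Σℚ m (f i))                ≡⟨ Σℚ-cong k (λ i → Σℚ≡sum m (f i)) ⟩
  Σℚ k (λ i → ∑.sum (f i))               ≡⟨ Σℚ≡sum k _ ⟩
  ∑.sum (λ i → ∑.sum (f i))              ≡⟨ ∑.∑-comm f ⟩
  ∑.sum (λ j → ∑.sum (λ i → f i j))      ≡⟨ Σℚ≡sum m _ ⟨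
  Σℚ m (λ j → ∑.sum (λ i → f i j))       ≡⟨ Σℚ-cong m (λ j → Σℚ≡sum k (λ i → f i j)) ⟨
  Σℚ m (λ j → Σℚ k (λ i → f i j))        ∎
  where open ≡-Reasoning

Σℚ-mono-≤ : ∀ k {f g : Fin k → ℚ} → (∀ i → f i ≤ g i) → Σℚ k f ≤ Σℚ k g
Σℚ-mono-≤ zero    f≤g = ℚP.≤-refl
Σℚ-mono-≤ (suc k) f≤g = ℚP.+-mono-≤ (f≤g zero) (Σℚ-mono-≤ k (f≤g ∘ suc))

Σℚ-nonneg : ∀ k {f : Fin k → ℚ} → (∀ i → 0ℚ ≤ f i) → 0ℚ ≤ Σℚ k f
Σℚ-nonneg k {f} 0≤f = subst (_≤ Σℚ k f) (Σℚ-zero k) (Σℚ-mono-≤ k 0≤f)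

Σℚ-↑ : ∀ k l (f : Fin (k ℕ.+ l) → ℚ) →
       Σℚ (k ℕ.+ l) f ≡ Σℚ k (λ i → f (i ↑ˡ l)) + Σℚ l (λ j → f (k ↑ʳ j))
Σℚ-↑ zero    l f = sym (ℚP.+-identityˡ _)
Σℚ-↑ (suc k) l f =
  trans (cong (f zero +_) (Σℚ-↑ k l (f ∘ suc))) (sym (ℚP.+-assoc (f zero) _ _))

Σℚ-single : ∀ k (f : Fin k → ℚ) i → (∀ j → j ≢ i → f j ≡ 0ℚ) → Σℚ k f ≡ f i
Σℚ-single (suc k) f zero    f≡0 =
  trans (cong (f zero +_) (trans (Σℚ-cong k (λ j → f≡0 (suc j) λ ())) (Σℚ-zero k))) (ℚP.+-identityʳ _)
Σℚ-single (suc k) f (suc i) f≡0 =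
  trans (cong₂ _+_ (f≡0 zero λ ()) (Σℚ-single k (f ∘ suc) i λ j j≢i → f≡0 (suc j) (j≢i ∘ FinP.suc-injective)))
        (ℚP.+-identityˡ _)

Σℚ-++ : ∀ {A : Set} {k l} (F : A → ℚ) (f : Fin k → A) (g : Fin l → A) →
        Σℚ (k ℕ.+ l) (λ i → F ((f ++ g) i)) ≡ Σℚ k (λ a → F (f a)) + Σℚ l (λ b → F (g b))
Σℚ-++ {k = k} {l} F f g = trans (Σℚ-↑ k l _)
  (cong₂ _+_ (Σℚ-cong k λ a → cong F (lookup-++ˡ f g a)) (Σℚ-cong l λ b → cong F (lookup-++ʳ f g b)))

ℕtoℚ≡mkℚ : ∀ m → ℕtoℚ m ≡ mkℚ (ℤ.+ m) 0 (Coprime.sym (Coprime.1-coprimeTo m))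
ℕtoℚ≡mkℚ m = ℚP.normalize-coprime (Coprime.sym (Coprime.1-coprimeTo m))

ℕtoℚ-+ : ∀ a b → ℕtoℚ (a ℕ.+ b) ≡ ℕtoℚ a + ℕtoℚ b
ℕtoℚ-+ a b = ℚP.toℚᵘ-injective (begin
  toℚᵘ (ℕtoℚ (a ℕ.+ b))                ≈⟨ ℚᵘP.≃-reflexive (cong toℚᵘ (ℕtoℚ≡mkℚ (a ℕ.+ b))) ⟩
  ℚᵘ.mkℚᵘ (ℤ.+ (a ℕ.+ b)) 0             ≈⟨ ℚᵘ.*≡* numerators ⟩
  ℚᵘ.mkℚᵘ (ℤ.+ a) 0 ℚᵘ.+ ℚᵘ.mkℚᵘ (ℤ.+ b) 0  ≈⟨ ℚᵘP.≃-reflexive (sym (cong₂ (λ p q → toℚᵘ p ℚᵘ.+ toℚᵘ q)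
                                                                        (ℕtoℚ≡mkℚ a) (ℕtoℚ≡mkℚ b))) ⟩
  toℚᵘ (ℕtoℚ a) ℚᵘ.+ toℚᵘ (ℕtoℚ b)       ≈⟨ ℚP.toℚᵘ-homo-+ (ℕtoℚ a) (ℕtoℚ b) ⟨
  toℚᵘ (ℕtoℚ a + ℕtoℚ b)               ∎)
  where
  open ℚᵘP.≃-Reasoning
  numerators : ℤ.+ (a ℕ.+ b) ℤ.* ℤ.1ℤ ≡ (ℤ.+ a ℤ.* ℤ.1ℤ ℤ.+ ℤ.+ b ℤ.* ℤ.1ℤ) ℤ.* ℤ.1ℤ
  numerators = trans (ℤP.*-identityʳ _) (trans (ℤP.pos-+ a b) (sym (trans (ℤP.*-identityʳ _)
    (cong₂ ℤ._+_ (ℤP.*-identityʳ (ℤ.+ a)) (ℤP.*-identityʳ (ℤ.+ b))))))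

lookup-⊆ : ∀ {n} {X Y : Subset n} → X ⊆ Y → ∀ {u} → lookup X u ≡ true → lookup Y u ≡ true
lookup-⊆ X⊆Y {u} Xu = []=⇒lookup (X⊆Y (lookup⇒[]= u _ Xu))

lookup-─ : ∀ {n} (X Y : Subset n) u → lookup (X ─ Y) u ≡ (lookup X u ∧ not (lookup Y u))
lookup-─ (x ∷ X) (true  ∷ Y) zero    = sym (BoolP.∧-zeroʳ x)
lookup-─ (x ∷ X) (false ∷ Y) zero    = sym (BoolP.∧-identityʳ x)
lookup-─ (x ∷ X) (y     ∷ Y) (suc u) = lookup-─ X Y u

lookup-∉ : ∀ {n} {X : Subset n} {u} → u ∉ X → lookup X u ≡ false
lookup-∉ {X = X} {u} u∉X with lookup X u in Xu
... | true  = ⊥-elim (u∉X (lookup⇒[]= u X Xu))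
... | false = refl

x∈p─q⇒x∉q : ∀ {n} (p q : Subset n) {x} → x ∈ p ─ q → x ∉ q
x∈p─q⇒x∉q (_ ∷ p) (true  ∷ q) (there x∈p─q) (there x∈q) = x∈p─q⇒x∉q p q x∈p─q x∈q
x∈p─q⇒x∉q (_ ∷ p) (false ∷ q) (there x∈p─q) (there x∈q) = x∈p─q⇒x∉q p q x∈p─q x∈q

⊆∪-empty : ∀ {n} {X X₁ X₂ : Subset n} → X ⊆ X₁ ∪ X₂ → ¬ Nonempty X₁ → ¬ Nonempty X₂ → ¬ Nonempty X
⊆∪-empty {X₁ = X₁} {X₂} X⊆X₁∪X₂ X₁≡∅ X₂≡∅ (x , x∈X) with x∈p∪q⁻ X₁ X₂ (X⊆X₁∪X₂ x∈X)
... | inj₁ x∈X₁ = X₁≡∅ (x , x∈X₁)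
... | inj₂ x∈X₂ = X₂≡∅ (x , x∈X₂)

p∩r⊆q∩r∪[p─q]∩r : ∀ {n} {p q : Subset n} r → p ∩ r ⊆ (q ∩ r) ∪ ((p ─ q) ∩ r)
p∩r⊆q∩r∪[p─q]∩r {p = p} {q} r {x} x∈p∩r with x∈p∩q⁻ p r x∈p∩r | x ∈? q
... | x∈p , x∈r | yes x∈q = x∈p∪q⁺ (inj₁ (x∈p∩q⁺ (x∈q , x∈r)))
... | x∈p , x∈r | no  x∉q = x∈p∪q⁺ (inj₂ (x∈p∩q⁺ (x∈p∧x∉q⇒x∈p─q x∈p x∉q , x∈r)))

p⊆q∧q─p≢∅⇒∣p∣<∣q∣ : ∀ {n} {p q : Subset n} → p ⊆ q → Nonempty (q ─ p) → ∣ p ∣ ℕ.< ∣ q ∣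
p⊆q∧q─p≢∅⇒∣p∣<∣q∣ {p = p} {q} p⊆q (x , x∈q─p) = p⊂q⇒∣p∣<∣q∣ (p⊆q , x , p─q⊆p q p x∈q─p , x∈p─q⇒x∉q q p x∈q─p)

p⊆q∧p≢∅⇒∣q─p∣<∣q∣ : ∀ {n} {p q : Subset n} → p ⊆ q → Nonempty p → ∣ q ─ p ∣ ℕ.< ∣ q ∣
p⊆q∧p≢∅⇒∣q─p∣<∣q∣ {p = p} {q} p⊆q (x , x∈p) = p⊂q⇒∣p∣<∣q∣ (p─q⊆p q p , x , p⊆q x∈p , λ x∈q─p → x∈p─q⇒x∉q q p x∈q─p x∈p)

++-all : ∀ {A : Set} {k l} (Q : A → Set) {f : Fin k → A} {g : Fin l → A} →
         (∀ a → Q (f a)) → (∀ b → Q (g b)) → ∀ i → Q ((f ++ g) i)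
++-all {k = k} Q Qf Qg i with splitAt k i
... | inj₁ a = Qf a
... | inj₂ b = Qg b

IsPartition-++ : ∀ {n k l} {Y S : Subset n} {f : Fin k → Subset n} {g : Fin l → Subset n} →
                 Y ⊆ S → IsPartition Y f → IsPartition (S ─ Y) g → IsPartition S (f ++ g)
IsPartition-++ {n} {k} {l} {Y} {S} {f} {g} Y⊆S (f≢∅ , f-disj , f⊆Y , f-covers) (g≢∅ , g-disj , g⊆S─Y , g-covers) =
  ++-all Nonempty f≢∅ g≢∅ , disjoint , ++-all (_⊆ S) (λ a → Y⊆S ∘ f⊆Y a) (λ b → p─q⊆p S Y ∘ g⊆S─Y b) , covers
  where
  disjoint : ∀ i j → i ≢ j → ∀ v → v ∈ (f ++ g) i → v ∉ (f ++ g) j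
  disjoint i j i≢j v with splitAt k i in si | splitAt k j in sj
  ... | inj₁ a | inj₁ b = f-disj a b (λ a≡b → i≢j (begin
    i       ≡⟨ FinP.splitAt⁻¹-↑ˡ si ⟨
    a ↑ˡ l  ≡⟨ cong (_↑ˡ l) a≡b ⟩
    b ↑ˡ l  ≡⟨ FinP.splitAt⁻¹-↑ˡ sj ⟩
    j       ∎)) v
    where open ≡-Reasoning
  ... | inj₂ a | inj₂ b = g-disj a b (λ a≡b → i≢j (begin
    i       ≡⟨ FinP.splitAt⁻¹-↑ʳ si ⟨
    k ↑ʳ a  ≡⟨ cong (k ↑ʳ_) a≡b ⟩
    k ↑ʳ b  ≡⟨ FinP.splitAt⁻¹-↑ʳ sj ⟩
    j       ∎)) v
    where open ≡-Reasoning
  ... | inj₁ a | inj₂ b = λ v∈fa v∈gb → x∈p─q⇒x∉q S Y (g⊆S─Y b v∈gb) (f⊆Y a v∈fa)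
  ... | inj₂ a | inj₁ b = λ v∈ga v∈fb → x∈p─q⇒x∉q S Y (g⊆S─Y a v∈ga) (f⊆Y b v∈fb)
  covers : ∀ v → v ∈ S → ∃ λ i → v ∈ (f ++ g) i
  covers v v∈S with v ∈? Y
  ... | yes v∈Y = let a , v∈fa = f-covers v v∈Y in a ↑ˡ l , subst (v ∈_) (sym (lookup-++ˡ f g a)) v∈fa
  ... | no  v∉Y = let b , v∈gb = g-covers v (x∈p∧x∉q⇒x∈p─q v∈S v∉Y) in k ↑ʳ b , subst (v ∈_) (sym (lookup-++ʳ f g b)) v∈gb

χᵇ : Bool → ℚ
χᵇ b = if b then 1ℚ else 0ℚ

χ : ∀ {n} → Subset n → Fin n → ℚ
χ X u = χᵇ (lookup X u)

if-else-0≡χᵇ* : ∀ b x → (if b then x else 0ℚ) ≡ χᵇ b * x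
if-else-0≡χᵇ* true  x = sym (ℚP.*-identityˡ x)
if-else-0≡χᵇ* false x = sym (ℚP.*-zeroˡ x)

if-else-0-nonneg : ∀ b {x} → 0ℚ ≤ x → 0ℚ ≤ (if b then x else 0ℚ)
if-else-0-nonneg true  0≤x = 0≤x
if-else-0-nonneg false _   = ℚP.≤-refl

χᵇ-∧ : ∀ a b → χᵇ (a ∧ b) ≡ χᵇ a * χᵇ b
χᵇ-∧ true  b = sym (ℚP.*-identityˡ (χᵇ b))
χᵇ-∧ false b = sym (ℚP.*-zeroˡ (χᵇ b))

χᵇ-nonneg : ∀ b → 0ℚ ≤ χᵇ b
χᵇ-nonneg true  = ℚP.nonNegative⁻¹ 1ℚ
χᵇ-nonneg false = ℚP.≤-refl

χ-∩ : ∀ {n} (X Y : Subset n) u → χ (X ∩ Y) u ≡ χ X u * χ Y u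
χ-∩ X Y u = trans (cong χᵇ (lookup-zipWith _∧_ u X Y)) (χᵇ-∧ (lookup X u) (lookup Y u))

χ-─ : ∀ {n} {X Y : Subset n} → Y ⊆ X → ∀ u → χ (X ─ Y) u ≡ χ X u - χ Y u
χ-─ {X = X} {Y} Y⊆X u rewrite lookup-─ X Y u with lookup X u in Xu | lookup Y u in Yu
... | true  | true  = refl
... | true  | false = refl
... | false | false = refl
... | false | true  with () ← trans (sym (lookup-⊆ Y⊆X Yu)) Xu

χ-partition : ∀ {n k} {X : Subset n} {P : Fin k → Subset n} → IsPartition X P →
              ∀ u → Σℚ k (λ i → χ (P i) u) ≡ χ X u
χ-partition {k = k} {X} {P} (_ , disjoint , P⊆X , covers) u with u ∈? X
... | no u∉X = begin
  Σℚ k (λ i → χ (P i) u)  ≡⟨ Σℚ-cong k (λ i → cong χᵇ (lookup-∉ (u∉X ∘ P⊆X i))) ⟩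
  Σℚ k (λ i → 0ℚ)         ≡⟨ Σℚ-zero k ⟩
  0ℚ                      ≡⟨ cong χᵇ (lookup-∉ u∉X) ⟨
  χ X u                   ∎
  where open ≡-Reasoning
... | yes u∈X with covers u u∈X
... | i , u∈Pi = begin
  Σℚ k (λ j → χ (P j) u)  ≡⟨ Σℚ-single k _ i (λ j j≢i → cong χᵇ (lookup-∉ (disjoint i j (j≢i ∘ sym) u u∈Pi))) ⟩
  χ (P i) u               ≡⟨ cong χᵇ (trans ([]=⇒lookup u∈Pi) (sym ([]=⇒lookup u∈X))) ⟩
  χ X u                   ∎
  where open ≡-Reasoning

card≡Σχ : ∀ {k} (p : Subset k) → ℕtoℚ ∣ p ∣ ≡ Σℚ k (χ p)
card≡Σχ []          = refl
card≡Σχ (true  ∷ p) = trans (ℕtoℚ-+ 1 ∣ p ∣) (cong (1ℚ +_) (card≡Σχ p))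
card≡Σχ (false ∷ p) = trans (card≡Σχ p) (sym (ℚP.+-identityˡ _))

χ≠∅ : ∀ {n} → Subset n → ℚ
χ≠∅ X = χᵇ (does (nonempty? X))

χ≠∅-yes : ∀ {n} {X : Subset n} → Nonempty X → χ≠∅ X ≡ 1ℚ
χ≠∅-yes {X = X} X≢∅ = cong χᵇ (dec-true (nonempty? X) X≢∅)

χ≠∅-no : ∀ {n} {X : Subset n} → ¬ Nonempty X → χ≠∅ X ≡ 0ℚ
χ≠∅-no {X = X} X≡∅ = cong χᵇ (dec-false (nonempty? X) X≡∅)

χ≠∅-nonneg : ∀ {n} (X : Subset n) → 0ℚ ≤ χ≠∅ X
χ≠∅-nonneg X = χᵇ-nonneg (does (nonempty? X))

χ≠∅≤1 : ∀ {n} (X : Subset n) → χ≠∅ X ≤ 1ℚ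
χ≠∅≤1 X with does (nonempty? X)
... | true  = ℚP.≤-refl
... | false = ℚP.nonNegative⁻¹ 1ℚ

-- Edge weights as a bilinear pairing

module _ {n : ℕ} (G : WGraph n) where

  pairing : (Fin n → ℚ) → (Fin n → ℚ) → ℚ
  pairing f g = Σℚ n λ u → Σℚ n λ v → f u * g v * w G u v

  wBetween≡pairing : ∀ X Y → wBetween G X Y ≡ pairing (χ X) (χ Y)
  wBetween≡pairing X Y = Σℚ-cong n λ u → Σℚ-cong n λ v →
    trans (if-else-0≡χᵇ* _ (w G u v)) (cong (_* w G u v) (χᵇ-∧ (lookup X u) (lookup Y v)))

  pairing-cong : ∀ {f f′ g g′ : Fin n → ℚ} → (∀ u → f u ≡ f′ u) → (∀ v → g v ≡ g′ v) → pairing f g ≡ pairing f′ g′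
  pairing-cong f≗f′ g≗g′ = Σℚ-cong n λ u → Σℚ-cong n λ v → cong₂ (λ a b → a * b * w G u v) (f≗f′ u) (g≗g′ v)

  pairing-zeroˡ : ∀ (f g : Fin n → ℚ) → (∀ u → f u ≡ 0ℚ) → pairing f g ≡ 0ℚ
  pairing-zeroˡ f g f≡0 = begin
    pairing f g                 ≡⟨ Σℚ-cong n (λ u → Σℚ-cong n (term≡0 u)) ⟩
    Σℚ n (λ u → Σℚ n λ v → 0ℚ)  ≡⟨ Σℚ-cong n (λ u → Σℚ-zero n) ⟩
    Σℚ n (λ u → 0ℚ)             ≡⟨ Σℚ-zero n ⟩
    0ℚ                          ∎
    where
    open ≡-Reasoning
    term≡0 : ∀ u v → f u * g v * w G u v ≡ 0ℚ
    term≡0 u v rewrite f≡0 u = trans (cong (_* w G u v) (ℚP.*-zeroˡ (g v))) (ℚP.*-zeroˡ (w G u v))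

  pairing-comm : ∀ (f g : Fin n → ℚ) → pairing f g ≡ pairing g f
  pairing-comm f g = trans (Σℚ-comm n n _) (Σℚ-cong n λ u → Σℚ-cong n λ v →
    trans (cong (f v * g u *_) (symm G v u)) (cong (_* w G u v) (ℚP.*-comm (f v) (g u))))

  pairing-Σˡ : ∀ k (f : Fin k → Fin n → ℚ) (g : Fin n → ℚ) →
               pairing (λ u → Σℚ k (λ i → f i u)) g ≡ Σℚ k (λ i → pairing (f i) g)
  pairing-Σˡ k f g = begin
    pairing (λ u → Σℚ k (λ i → f i u)) g
      ≡⟨ Σℚ-cong n (λ u → Σℚ-cong n λ v → trans (ℚP.*-assoc (Σℚ k (λ i → f i u)) (g v) (w G u v))
                                                  (sym (Σℚ-*ʳ k (g v * w G u v) (λ i → f i u)))) ⟩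
    Σℚ n (λ u → Σℚ n λ v → Σℚ k λ i → f i u * (g v * w G u v))
      ≡⟨ Σℚ-cong n (λ u → Σℚ-comm n k _) ⟩
    Σℚ n (λ u → Σℚ k λ i → Σℚ n λ v → f i u * (g v * w G u v))
      ≡⟨ Σℚ-comm n k _ ⟩
    Σℚ k (λ i → Σℚ n λ u → Σℚ n λ v → f i u * (g v * w G u v))
      ≡⟨ Σℚ-cong k (λ i → Σℚ-cong n λ u → Σℚ-cong n λ v → sym (ℚP.*-assoc (f i u) (g v) (w G u v))) ⟩
    Σℚ k (λ i → pairing (f i) g)
      ∎
    where open ≡-Reasoning

  private
    Σ² : (Fin n → Fin n → ℚ) → ℚ
    Σ² F = Σℚ n λ u → Σℚ n λ v → F u v

    Σ²-+ : ∀ F H → Σ² (λ u v → F u v + H u v) ≡ Σ² F + Σ² H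
    Σ²-+ F H = trans (Σℚ-cong n λ u → Σℚ-+ n (F u) (H u)) (Σℚ-+ n _ _)

  -- ∂X₁ + ∂X₂ = ∂(X₁ ∪ X₂) + w(X₁, X₂) + w(X₂, X₁), written for characteristic vectors x₁, x₂ ≤ a.
  pairing-split : ∀ (x₁ x₂ a : Fin n → ℚ) →
    pairing x₁ (λ v → a v - x₁ v) + pairing x₂ (λ v → a v - x₂ v) ≡
    pairing (λ u → x₁ u + x₂ u) (λ v → a v - (x₁ v + x₂ v)) + (pairing x₁ x₂ + pairing x₂ x₁)
  pairing-split x₁ x₂ a = begin
    pairing x₁ (λ v → a v - x₁ v) + pairing x₂ (λ v → a v - x₂ v)
      ≡⟨ Σ²-+ (λ u v → x₁ u * (a v - x₁ v) * w G u v) (λ u v → x₂ u * (a v - x₂ v) * w G u v) ⟨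
    Σ² (λ u v → x₁ u * (a v - x₁ v) * w G u v + x₂ u * (a v - x₂ v) * w G u v)
      ≡⟨ Σℚ-cong n (λ u → Σℚ-cong n λ v → edge (x₁ u) (x₂ u) (x₁ v) (x₂ v) (a v) (w G u v)) ⟩
    Σ² (λ u v → (x₁ u + x₂ u) * (a v - (x₁ v + x₂ v)) * w G u v
               + (x₁ u * x₂ v * w G u v + x₂ u * x₁ v * w G u v))
      ≡⟨ trans (Σ²-+ (λ u v → (x₁ u + x₂ u) * (a v - (x₁ v + x₂ v)) * w G u v) _)
               (cong (pairing (λ u → x₁ u + x₂ u) (λ v → a v - (x₁ v + x₂ v)) +_)
                     (Σ²-+ (λ u v → x₁ u * x₂ v * w G u v) (λ u v → x₂ u * x₁ v * w G u v))) ⟩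
    pairing (λ u → x₁ u + x₂ u) (λ v → a v - (x₁ v + x₂ v)) + (pairing x₁ x₂ + pairing x₂ x₁)
      ∎
    where
    open ≡-Reasoning
    edge : ∀ p q p′ q′ b e → p * (b - p′) * e + q * (b - q′) * e ≡ (p + q) * (b - (p′ + q′)) * e + (p * q′ * e + q * p′ * e)
    edge = solve 6 (λ p q p′ q′ b e →
      p :* (b :- p′) :* e :+ q :* (b :- q′) :* e := (p :+ q) :* (b :- (p′ :+ q′)) :* e :+ (p :* q′ :* e :+ q :* p′ :* e)) refl

  wBetween-comm : ∀ X Y → wBetween G X Y ≡ wBetween G Y X
  wBetween-comm X Y =
    trans (wBetween≡pairing X Y) (trans (pairing-comm (χ X) (χ Y)) (sym (wBetween≡pairing Y X)))

  wBetween-emptyˡ : ∀ {X} Y → ¬ Nonempty X → wBetween G X Y ≡ 0ℚ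
  wBetween-emptyˡ {X} Y X≡∅ = trans (wBetween≡pairing X Y)
    (pairing-zeroˡ (χ X) (χ Y) λ u → cong χᵇ (lookup-∉ λ u∈X → X≡∅ (u , u∈X)))

  wBetween-emptyʳ : ∀ X {Y} → ¬ Nonempty Y → wBetween G X Y ≡ 0ℚ
  wBetween-emptyʳ X {Y} Y≡∅ = trans (wBetween-comm X Y) (wBetween-emptyˡ X Y≡∅)

  wBetween-mono : ∀ {X X′ Y Y′} → X ⊆ X′ → Y ⊆ Y′ → wBetween G X Y ≤ wBetween G X′ Y′
  wBetween-mono {X} {X′} {Y} {Y′} X⊆X′ Y⊆Y′ = Σℚ-mono-≤ n λ u → Σℚ-mono-≤ n λ v → edge u v
    where
    edge : ∀ u v → (if lookup X u ∧ lookup Y v then w G u v else 0ℚ)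
                 ≤ (if lookup X′ u ∧ lookup Y′ v then w G u v else 0ℚ)
    edge u v with lookup X u in Xu | lookup Y v in Yv
    ... | true  | true  rewrite lookup-⊆ X⊆X′ Xu | lookup-⊆ Y⊆Y′ Yv = ℚP.≤-refl
    ... | true  | false = if-else-0-nonneg (lookup X′ u ∧ lookup Y′ v) (nonneg G u v)
    ... | false | _     = if-else-0-nonneg (lookup X′ u ∧ lookup Y′ v) (nonneg G u v)

  wBetween-nonneg : ∀ X Y → 0ℚ ≤ wBetween G X Y
  wBetween-nonneg X Y = Σℚ-nonneg n λ u → Σℚ-nonneg n λ v →
    if-else-0-nonneg (lookup X u ∧ lookup Y v) (nonneg G u v)

  wBetween-partitionˡ : ∀ {k X} {P : Fin k → Subset n} → IsPartition X P →
                        ∀ Z → Σℚ k (λ i → wBetween G (P i) Z) ≡ wBetween G X Z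
  wBetween-partitionˡ {k} {X} {P} part Z = begin
    Σℚ k (λ i → wBetween G (P i) Z)                ≡⟨ Σℚ-cong k (λ i → wBetween≡pairing (P i) Z) ⟩
    Σℚ k (λ i → pairing (χ (P i)) (χ Z))           ≡⟨ pairing-Σˡ k (λ i → χ (P i)) (χ Z) ⟨
    pairing (λ u → Σℚ k (λ i → χ (P i) u)) (χ Z)   ≡⟨ pairing-cong (χ-partition part) (λ _ → refl) ⟩
    pairing (χ X) (χ Z)                            ≡⟨ wBetween≡pairing X Z ⟨
    wBetween G X Z                                 ∎
    where open ≡-Reasoning

  wBetween-partitionʳ : ∀ {k Z} {P : Fin k → Subset n} → IsPartition Z P →
                        ∀ X → Σℚ k (λ i → wBetween G X (P i)) ≡ wBetween G X Z
  wBetween-partitionʳ {k} {Z} {P} part X = begin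
    Σℚ k (λ i → wBetween G X (P i))  ≡⟨ Σℚ-cong k (λ i → wBetween-comm X (P i)) ⟩
    Σℚ k (λ i → wBetween G (P i) X)  ≡⟨ wBetween-partitionˡ part X ⟩
    wBetween G Z X                   ≡⟨ wBetween-comm Z X ⟩
    wBetween G X Z                   ∎
    where open ≡-Reasoning

  boundaryIn≡pairing : ∀ {B X} → X ⊆ B → boundaryIn G B X ≡ pairing (χ X) (λ v → χ B v - χ X v)
  boundaryIn≡pairing {B} {X} X⊆B = trans (wBetween≡pairing X (B ─ X)) (pairing-cong {χ X} (λ _ → refl) (χ-─ X⊆B))

  boundaryIn-∪ : ∀ {B X X₁ X₂} → X₁ ⊆ B → X₂ ⊆ B → X ⊆ B → (∀ u → χ X u ≡ χ X₁ u + χ X₂ u) →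
    boundaryIn G B X₁ + boundaryIn G B X₂ ≡ boundaryIn G B X + (wBetween G X₁ X₂ + wBetween G X₂ X₁)
  boundaryIn-∪ {B} {X} {X₁} {X₂} X₁⊆B X₂⊆B X⊆B χX≡ = begin
    boundaryIn G B X₁ + boundaryIn G B X₂
      ≡⟨ cong₂ _+_ (boundaryIn≡pairing X₁⊆B) (boundaryIn≡pairing X₂⊆B) ⟩
    pairing (χ X₁) (λ v → χ B v - χ X₁ v) + pairing (χ X₂) (λ v → χ B v - χ X₂ v)
      ≡⟨ pairing-split (χ X₁) (χ X₂) (χ B) ⟩
    pairing (λ u → χ X₁ u + χ X₂ u) (λ v → χ B v - (χ X₁ v + χ X₂ v)) + (pairing (χ X₁) (χ X₂) + pairing (χ X₂) (χ X₁))
      ≡⟨ cong₂ _+_ (trans (pairing-cong (sym ∘ χX≡) (λ v → cong (χ B v -_) (sym (χX≡ v)))) (sym (boundaryIn≡pairing X⊆B)))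
                   (sym (cong₂ _+_ (wBetween≡pairing X₁ X₂) (wBetween≡pairing X₂ X₁))) ⟩
    boundaryIn G B X + (wBetween G X₁ X₂ + wBetween G X₂ X₁)
      ∎
    where open ≡-Reasoning

module _ {n : ℕ} (G : WGraph n) where

  trace∂ : Subset n → Subset n → ℚ
  trace∂ A′ X = boundaryIn G A′ (X ∩ A′)

  trace∂-split : ∀ {Y S} A′ → Y ⊆ S →
    trace∂ A′ Y + trace∂ A′ (S ─ Y)
      ≡ trace∂ A′ S + (wBetween G (Y ∩ A′) ((S ─ Y) ∩ A′) + wBetween G ((S ─ Y) ∩ A′) (Y ∩ A′))
  trace∂-split {Y} {S} A′ Y⊆S = boundaryIn-∪ G (p∩q⊆q Y A′) (p∩q⊆q (S ─ Y) A′) (p∩q⊆q S A′) χ-trace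
    where
    χ-trace : ∀ u → χ (S ∩ A′) u ≡ χ (Y ∩ A′) u + χ ((S ─ Y) ∩ A′) u
    χ-trace u = begin
      χ (S ∩ A′) u                         ≡⟨ χ-∩ S A′ u ⟩
      χ S u * χ A′ u                       ≡⟨ solve 3 (λ s y a → s :* a := y :* a :+ (s :- y) :* a) refl (χ S u) (χ Y u) (χ A′ u) ⟩
      χ Y u * χ A′ u + (χ S u - χ Y u) * χ A′ u
                                           ≡⟨ cong (χ Y u * χ A′ u +_) (cong (_* χ A′ u) (χ-─ Y⊆S u)) ⟨
      χ Y u * χ A′ u + χ (S ─ Y) u * χ A′ u ≡⟨ cong₂ _+_ (χ-∩ Y A′ u) (χ-∩ (S ─ Y) A′ u) ⟨
      χ (Y ∩ A′) u + χ ((S ─ Y) ∩ A′) u    ∎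
      where open ≡-Reasoning

module _ {n : ℕ} (G : WGraph n) {c : ℚ} (0≤c : 0ℚ ≤ c) where

  private
    c*χ≠∅≤c : ∀ (X : Subset n) → c * χ≠∅ X ≤ c * 1ℚ
    c*χ≠∅≤c X = ℚP.*-monoˡ-≤-nonNeg c {{nonNegative 0≤c}} (χ≠∅≤1 X)

  -- If both sides are nonempty the two indicators pay for χ≠∅ X and for the crossing; otherwise the crossing is empty.
  χ≠∅-split : ∀ {X X₁ X₂ : Subset n} → X ⊆ X₁ ∪ X₂ → wBetween G X₁ X₂ ≤ c →
              c * χ≠∅ X + wBetween G X₁ X₂ ≤ c * χ≠∅ X₁ + c * χ≠∅ X₂
  χ≠∅-split {X} {X₁} {X₂} X⊆X₁∪X₂ w≤c with nonempty? X₁ | nonempty? X₂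
  ... | yes _    | yes _ =
    ℚP.+-mono-≤ (c*χ≠∅≤c X) (subst (_ ≤_) (sym (ℚP.*-identityʳ c)) w≤c)
  ... | yes _    | no  X₂≡∅ rewrite wBetween-emptyʳ G X₁ X₂≡∅ =
    ℚP.+-mono-≤ (c*χ≠∅≤c X) (ℚP.≤-reflexive (sym (ℚP.*-zeroʳ c)))
  ... | no  X₁≡∅ | yes _    rewrite wBetween-emptyˡ G X₂ X₁≡∅ =
    subst (c * χ≠∅ X + 0ℚ ≤_) (ℚP.+-comm (c * 1ℚ) (c * 0ℚ))
      (ℚP.+-mono-≤ (c*χ≠∅≤c X) (ℚP.≤-reflexive (sym (ℚP.*-zeroʳ c))))
  ... | no  X₁≡∅ | no  X₂≡∅ rewrite wBetween-emptyˡ G X₂ X₁≡∅ | χ≠∅-no (⊆∪-empty X⊆X₁∪X₂ X₁≡∅ X₂≡∅) =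
    ℚP.+-monoʳ-≤ (c * 0ℚ) (ℚP.≤-reflexive (sym (ℚP.*-zeroʳ c)))

<ᵇ-true : ∀ {m n} → m ℕ.< n → (m <ᵇ n) ≡ true
<ᵇ-true {m} {n} = dec-true (m ℕP.<? n)

<ᵇ-false : ∀ {m n} → n ℕ.≤ m → (m <ᵇ n) ≡ false
<ᵇ-false {m} {n} n≤m = dec-false (m ℕP.<? n) (ℕP.≤⇒≯ n≤m)

+-<ᵇ-+ : ∀ k {a b} → (k ℕ.+ a <ᵇ k ℕ.+ b) ≡ (a <ᵇ b)
+-<ᵇ-+ zero    = refl
+-<ᵇ-+ (suc k) = +-<ᵇ-+ k

module _ {n : ℕ} (G : WGraph n) where

  wParts-++ : ∀ {k l} (f : Fin k → Subset n) (g : Fin l → Subset n) →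
    wParts G (f ++ g) ≡ (wParts G f + Σℚ k (λ a → Σℚ l (λ b → wBetween G (f a) (g b)))) + wParts G g
  wParts-++ {k} {l} f g = begin
    wParts G (f ++ g)
      ≡⟨ Σℚ-↑ k l _ ⟩
    Σℚ k (λ a → Σℚ (k ℕ.+ l) (O (a ↑ˡ l))) + Σℚ l (λ b → Σℚ (k ℕ.+ l) (O (k ↑ʳ b)))
      ≡⟨ cong₂ _+_ (Σℚ-cong k λ a → Σℚ-↑ k l _) (Σℚ-cong l λ b → Σℚ-↑ k l _) ⟩
    Σℚ k (λ a → Σℚ k (λ a′ → O (a ↑ˡ l) (a′ ↑ˡ l)) + Σℚ l (λ b′ → O (a ↑ˡ l) (k ↑ʳ b′))) +
    Σℚ l (λ b → Σℚ k (λ a′ → O (k ↑ʳ b) (a′ ↑ˡ l)) + Σℚ l (λ b′ → O (k ↑ʳ b) (k ↑ʳ b′)))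
      ≡⟨ cong₂ _+_ (Σℚ-+ k _ _) (Σℚ-+ l _ _) ⟩
    (Σℚ k (λ a → Σℚ k (λ a′ → O (a ↑ˡ l) (a′ ↑ˡ l))) + Σℚ k (λ a → Σℚ l (λ b′ → O (a ↑ˡ l) (k ↑ʳ b′)))) +
    (Σℚ l (λ b → Σℚ k (λ a′ → O (k ↑ʳ b) (a′ ↑ˡ l))) + Σℚ l (λ b → Σℚ l (λ b′ → O (k ↑ʳ b) (k ↑ʳ b′))))
      ≡⟨ cong₂ _+_ (cong₂ _+_ (Σ²-cong k k left-left) (Σ²-cong k l left-right))
                   (cong₂ _+_ (trans (Σ²-cong l k right-left) (trans (Σℚ-cong l λ _ → Σℚ-zero k) (Σℚ-zero l)))
                              (Σ²-cong l l right-right)) ⟩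
    (wParts G f + Σℚ k (λ a → Σℚ l (λ b → wBetween G (f a) (g b)))) + (0ℚ + wParts G g)
      ≡⟨ cong (wParts G f + Σℚ k (λ a → Σℚ l (λ b → wBetween G (f a) (g b))) +_) (ℚP.+-identityˡ (wParts G g)) ⟩
    (wParts G f + Σℚ k (λ a → Σℚ l (λ b → wBetween G (f a) (g b)))) + wParts G g
      ∎
    where
    open ≡-Reasoning
    O : Fin (k ℕ.+ l) → Fin (k ℕ.+ l) → ℚ
    O i j = if toℕ i <ᵇ toℕ j then wBetween G ((f ++ g) i) ((f ++ g) j) else 0ℚ
    Σ²-cong : ∀ p q {F H : Fin p → Fin q → ℚ} → (∀ i j → F i j ≡ H i j) →
              Σℚ p (λ i → Σℚ q (F i)) ≡ Σℚ p (λ i → Σℚ q (H i))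
    Σ²-cong p q F≡H = Σℚ-cong p λ i → Σℚ-cong q (F≡H i)
    left-left : ∀ a a′ → O (a ↑ˡ l) (a′ ↑ˡ l) ≡ (if toℕ a <ᵇ toℕ a′ then wBetween G (f a) (f a′) else 0ℚ)
    left-left a a′ rewrite FinP.toℕ-↑ˡ a l | FinP.toℕ-↑ˡ a′ l | lookup-++ˡ f g a | lookup-++ˡ f g a′ = refl
    left-right : ∀ a b → O (a ↑ˡ l) (k ↑ʳ b) ≡ wBetween G (f a) (g b)
    left-right a b rewrite FinP.toℕ-↑ˡ a l | FinP.toℕ-↑ʳ k b | lookup-++ˡ f g a | lookup-++ʳ f g b
      | <ᵇ-true (ℕP.<-≤-trans (FinP.toℕ<n a) (ℕP.m≤m+n k (toℕ b))) = refl
    right-left : ∀ b a → O (k ↑ʳ b) (a ↑ˡ l) ≡ 0ℚ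
    right-left b a rewrite FinP.toℕ-↑ˡ a l | FinP.toℕ-↑ʳ k b
      | <ᵇ-false (ℕP.≤-trans (ℕP.<⇒≤ (FinP.toℕ<n a)) (ℕP.m≤m+n k (toℕ b))) = refl
    right-right : ∀ b b′ → O (k ↑ʳ b) (k ↑ʳ b′) ≡ (if toℕ b <ᵇ toℕ b′ then wBetween G (g b) (g b′) else 0ℚ)
    right-right b b′ rewrite FinP.toℕ-↑ʳ k b | FinP.toℕ-↑ʳ k b′ | +-<ᵇ-+ k {toℕ b} {toℕ b′}
      | lookup-++ʳ f g b | lookup-++ʳ f g b′ = refl

-- Splitting into well-connected clusters

+-cancelʳ-≤ : ∀ a b z → a + z ≤ b + z → a ≤ b
+-cancelʳ-≤ a b z a+z≤b+z = subst₂ _≤_ (cancel a) (cancel b) (ℚP.+-monoˡ-≤ (ℚ.- z) a+z≤b+z)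
  where
  cancel : ∀ x → x + z - z ≡ x
  cancel x = solve 2 (λ x z → x :+ z :- z := x) refl x z

crossing-merge : ∀ W₁ W₂ {X c a₁ a₂} → W₁ + c ≤ a₁ → W₂ + c ≤ a₂ → X ≤ c → ((W₁ + X) + W₂) + c ≤ a₁ + a₂
crossing-merge W₁ W₂ {X} {c} {a₁} {a₂} h₁ h₂ X≤c = begin
  ((W₁ + X) + W₂) + c  ≤⟨ ℚP.+-monoˡ-≤ c (ℚP.+-monoˡ-≤ W₂ (ℚP.+-monoʳ-≤ W₁ X≤c)) ⟩
  ((W₁ + c) + W₂) + c  ≡⟨ solve 3 (λ W₁ W₂ c → ((W₁ :+ c) :+ W₂) :+ c := (W₁ :+ c) :+ (W₂ :+ c)) refl W₁ W₂ c ⟩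
  (W₁ + c) + (W₂ + c)  ≤⟨ ℚP.+-mono-≤ h₁ h₂ ⟩
  a₁ + a₂              ∎
  where open ℚP.≤-Reasoning

boundary-merge : ∀ s₁ s₂ d d₁ d₂ x c {e e₁ e₂ N₁ N₂} →
  s₁ + (c + c) * e₁ ≤ d₁ + (c + c) * N₁ → s₂ + (c + c) * e₂ ≤ d₂ + (c + c) * N₂ →
  d₁ + d₂ ≡ d + (x + x) → c * e + x ≤ c * e₁ + c * e₂ →
  (s₁ + s₂) + (c + c) * e ≤ d + (c + c) * (N₁ + N₂)
boundary-merge s₁ s₂ d d₁ d₂ x c {e} {e₁} {e₂} {N₁} {N₂} h₁ h₂ d₁+d₂≡ he =
  +-cancelʳ-≤ _ _ (x + x) (begin
    ((s₁ + s₂) + (c + c) * e) + (x + x)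
      ≡⟨ solve 5 (λ s₁ s₂ c e x → ((s₁ :+ s₂) :+ (c :+ c) :* e) :+ (x :+ x)
                                 := (s₁ :+ s₂) :+ ((c :* e :+ x) :+ (c :* e :+ x))) refl s₁ s₂ c e x ⟩
    (s₁ + s₂) + ((c * e + x) + (c * e + x))
      ≤⟨ ℚP.+-monoʳ-≤ (s₁ + s₂) (ℚP.+-mono-≤ he he) ⟩
    (s₁ + s₂) + ((c * e₁ + c * e₂) + (c * e₁ + c * e₂))
      ≡⟨ solve 5 (λ s₁ s₂ c e₁ e₂ → (s₁ :+ s₂) :+ ((c :* e₁ :+ c :* e₂) :+ (c :* e₁ :+ c :* e₂))
                                    := (s₁ :+ (c :+ c) :* e₁) :+ (s₂ :+ (c :+ c) :* e₂)) refl s₁ s₂ c e₁ e₂ ⟩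
    (s₁ + (c + c) * e₁) + (s₂ + (c + c) * e₂)
      ≤⟨ ℚP.+-mono-≤ h₁ h₂ ⟩
    (d₁ + (c + c) * N₁) + (d₂ + (c + c) * N₂)
      ≡⟨ solve 5 (λ d₁ d₂ c N₁ N₂ → (d₁ :+ (c :+ c) :* N₁) :+ (d₂ :+ (c :+ c) :* N₂)
                                    := (d₁ :+ d₂) :+ (c :+ c) :* (N₁ :+ N₂)) refl d₁ d₂ c N₁ N₂ ⟩
    (d₁ + d₂) + (c + c) * (N₁ + N₂)
      ≡⟨ cong (_+ (c + c) * (N₁ + N₂)) d₁+d₂≡ ⟩
    (d + (x + x)) + (c + c) * (N₁ + N₂)
      ≡⟨ solve 4 (λ d x c N → (d :+ (x :+ x)) :+ c :* N := (d :+ c :* N) :+ (x :+ x)) refl d x (c + c) (N₁ + N₂) ⟩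
    (d + (c + c) * (N₁ + N₂)) + (x + x)
      ∎)
  where open ℚP.≤-Reasoning

module _ {n : ℕ} (G : WGraph n) (c : ℚ) where

  -- crossing says w(P₁, …, P_k) ≤ c (k − 1) when S ≠ ∅; boundary says that inside any A′ the traced
  -- boundaries of the parts exceed that of S by at most 2c for each part meeting A′ beyond the first.
  record Clustering (S : Subset n) : Set where
    field
      k         : ℕ
      P         : Fin k → Subset n
      partition : IsPartition S P
      minCut    : ∀ i → MinCutAtLeast G (P i) c
      crossing  : wParts G P + c * χ≠∅ S ≤ c * ℕtoℚ k
      boundary  : ∀ A′ → Σℚ k (λ i → trace∂ G A′ (P i)) + (c + c) * χ≠∅ (S ∩ A′)
                           ≤ trace∂ G A′ S + (c + c) * Σℚ k (λ i → χ≠∅ (P i ∩ A′))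

module _ {n : ℕ} (G : WGraph n) {c : ℚ} (0≤c : 0ℚ ≤ c) where

  clustering-∅ : ∀ {S} → ¬ Nonempty S → Clustering G c S
  clustering-∅ {S} S≡∅ = record
    { k         = 0
    ; P         = λ ()
    ; partition = (λ ()) , (λ ()) , (λ ()) , λ v v∈S → ⊥-elim (S≡∅ (v , v∈S))
    ; minCut    = λ ()
    ; crossing  = ℚP.≤-reflexive (trans (cong (λ e → 0ℚ + c * e) (χ≠∅-no S≡∅)) (ℚP.+-identityˡ (c * 0ℚ)))
    ; boundary  = λ A′ → subst (λ e → 0ℚ + (c + c) * e ≤ trace∂ G A′ S + (c + c) * 0ℚ)
                               (sym (χ≠∅-no (S≡∅ ∘ S∩A′≢∅⇒S≢∅ A′)))
                               (ℚP.+-monoˡ-≤ ((c + c) * 0ℚ) (wBetween-nonneg G (S ∩ A′) (A′ ─ S ∩ A′)))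
    }
    where
    S∩A′≢∅⇒S≢∅ : ∀ A′ → Nonempty (S ∩ A′) → Nonempty S
    S∩A′≢∅⇒S≢∅ A′ (v , v∈S∩A′) = v , p∩q⊆p S A′ v∈S∩A′

  clustering-single : ∀ {S} → Nonempty S → MinCutAtLeast G S c → Clustering G c S
  clustering-single {S} S≢∅ minCutS = record
    { k         = 1
    ; P         = λ _ → S
    ; partition = (λ _ → S≢∅) , (λ { zero zero 0≢0 → ⊥-elim (0≢0 refl) }) , (λ _ → id) , λ v v∈S → zero , v∈S
    ; minCut    = λ _ → minCutS
    ; crossing  = ℚP.≤-reflexive (trans (cong (λ e → 0ℚ + c * e) (χ≠∅-yes S≢∅)) (ℚP.+-identityˡ (c * 1ℚ)))
    ; boundary  = λ A′ → ℚP.≤-reflexive (cong₂ (λ x y → x + (c + c) * y)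
                                               (ℚP.+-identityʳ (trace∂ G A′ S)) (sym (ℚP.+-identityʳ (χ≠∅ (S ∩ A′)))))
    }

  private
    c*χ≠∅≡c : ∀ {X : Subset n} → Nonempty X → c * χ≠∅ X ≡ c
    c*χ≠∅≡c X≢∅ = trans (cong (c *_) (χ≠∅-yes X≢∅)) (ℚP.*-identityʳ c)

  clustering-merge : ∀ {Y S} → Y ⊆ S → Nonempty Y → Nonempty (S ─ Y) → wBetween G Y (S ─ Y) ≤ c →
                     Clustering G c Y → Clustering G c (S ─ Y) → Clustering G c S
  clustering-merge {Y} {S} Y⊆S Y≢∅ S─Y≢∅ light 𝒞₁ 𝒞₂ = record
    { k         = k₁ ℕ.+ k₂
    ; P         = f ++ g
    ; partition = IsPartition-++ Y⊆S partition₁ partition₂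
    ; minCut    = ++-all (λ X → MinCutAtLeast G X c) minCut₁ minCut₂
    ; crossing  = crossing
    ; boundary  = boundary
    }
    where
    open Clustering 𝒞₁ renaming (k to k₁; P to f; partition to partition₁; minCut to minCut₁;
                                 crossing to crossing₁; boundary to boundary₁)
    open Clustering 𝒞₂ renaming (k to k₂; P to g; partition to partition₂; minCut to minCut₂;
                                 crossing to crossing₂; boundary to boundary₂)
    S≢∅ : Nonempty S
    S≢∅ = proj₁ Y≢∅ , Y⊆S (proj₂ Y≢∅)
    cross : Σℚ k₁ (λ a → Σℚ k₂ (λ b → wBetween G (f a) (g b))) ≡ wBetween G Y (S ─ Y)
    cross = trans (Σℚ-cong k₁ λ a → wBetween-partitionʳ G partition₂ (f a)) (wBetween-partitionˡ G partition₁ (S ─ Y))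
    crossing : wParts G (f ++ g) + c * χ≠∅ S ≤ c * ℕtoℚ (k₁ ℕ.+ k₂)
    crossing = subst₂ _≤_
      (sym (cong₂ _+_ (trans (wParts-++ G f g) (cong (λ x → (wParts G f + x) + wParts G g) cross)) (c*χ≠∅≡c S≢∅)))
      (sym (trans (cong (c *_) (ℕtoℚ-+ k₁ k₂)) (ℚP.*-distribˡ-+ c _ _)))
      (crossing-merge (wParts G f) (wParts G g) (subst (λ x → wParts G f + x ≤ _) (c*χ≠∅≡c Y≢∅) crossing₁)
                      (subst (λ x → wParts G g + x ≤ _) (c*χ≠∅≡c S─Y≢∅) crossing₂) light)
    boundary : ∀ A′ → Σℚ (k₁ ℕ.+ k₂) (λ i → trace∂ G A′ ((f ++ g) i)) + (c + c) * χ≠∅ (S ∩ A′)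
                        ≤ trace∂ G A′ S + (c + c) * Σℚ (k₁ ℕ.+ k₂) (λ i → χ≠∅ ((f ++ g) i ∩ A′))
    boundary A′ = subst₂ _≤_
      (cong (_+ (c + c) * χ≠∅ (S ∩ A′)) (sym (Σℚ-++ (trace∂ G A′) f g)))
      (cong (λ N → trace∂ G A′ S + (c + c) * N) (sym (Σℚ-++ (λ X → χ≠∅ (X ∩ A′)) f g)))
      (boundary-merge (Σℚ k₁ (trace∂ G A′ ∘ f)) (Σℚ k₂ (trace∂ G A′ ∘ g)) (trace∂ G A′ S) (trace∂ G A′ Y) (trace∂ G A′ (S ─ Y))
        (wBetween G (Y ∩ A′) ((S ─ Y) ∩ A′)) c
        (boundary₁ A′) (boundary₂ A′)
        (trans (trace∂-split G A′ Y⊆S) (cong (λ x → trace∂ G A′ S + (wBetween G (Y ∩ A′) ((S ─ Y) ∩ A′) + x))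
                                             (wBetween-comm G ((S ─ Y) ∩ A′) (Y ∩ A′))))
        (χ≠∅-split G 0≤c {S ∩ A′} {Y ∩ A′} {(S ─ Y) ∩ A′} (p∩r⊆q∩r∪[p─q]∩r {p = S} {Y} A′)
          (ℚP.≤-trans (wBetween-mono G (p∩q⊆p Y A′) (p∩q⊆p (S ─ Y) A′)) light)))

  LightCut : Subset n → Subset n → Set
  LightCut S Y = Y ⊆ S × Nonempty Y × Nonempty (S ─ Y) × wBetween G Y (S ─ Y) < c

  lightCut? : ∀ S Y → Dec (LightCut S Y)
  lightCut? S Y = Y ⊆? S ×-dec nonempty? Y ×-dec nonempty? (S ─ Y) ×-dec wBetween G Y (S ─ Y) ℚP.<? c

  clustering-acc : ∀ S → Acc ℕ._<_ ∣ S ∣ → Clustering G c S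
  clustering-acc S (acc smaller) with nonempty? S
  ... | no  S≡∅ = clustering-∅ S≡∅
  ... | yes S≢∅ with anySubset? (lightCut? S)
  ... | no  noLightCut = clustering-single S≢∅ λ Y Y⊆S Y≢∅ S─Y≢∅ →
          ℚP.≮⇒≥ λ light → noLightCut (Y , Y⊆S , Y≢∅ , S─Y≢∅ , light)
  ... | yes (Y , Y⊆S , Y≢∅ , S─Y≢∅ , light) = clustering-merge Y⊆S Y≢∅ S─Y≢∅ (ℚP.<⇒≤ light)
          (clustering-acc Y (smaller (p⊆q∧q─p≢∅⇒∣p∣<∣q∣ Y⊆S S─Y≢∅)))
          (clustering-acc (S ─ Y) (smaller (p⊆q∧p≢∅⇒∣q─p∣<∣q∣ Y⊆S Y≢∅)))

  clustering : ∀ S → Clustering G c S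
  clustering S = clustering-acc S (<-wellFounded ∣ S ∣)

-- Counting the light parts

atMost : ∀ {k} → (Fin k → ℚ) → ℚ → Subset k
atMost b t = tabulate λ i → does (b i ℚP.≤? t)

∈atMost⇒≤ : ∀ {k} {b : Fin k → ℚ} {t i} → i ∈ atMost b t → b i ≤ t
∈atMost⇒≤ {b = b} {t} {i} i∈ =
  yes-witness (b i ℚP.≤? t) (trans (sym (lookup∘tabulate _ i)) ([]=⇒lookup i∈))
  where
  yes-witness : ∀ {P : Set} (P? : Dec P) → does P? ≡ true → P
  yes-witness (yes p) _ = p

-- Markov's inequality: each index of I outside the t-sublevel set carries more than t.
markov : ∀ {k} (I : Subset k) (b : Fin k → ℚ) t → (∀ i → 0ℚ ≤ b i) →
         t * ℕtoℚ ∣ I ∣ ≤ t * ℕtoℚ ∣ I ∩ atMost b t ∣ + Σℚ k b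
markov {k} I b t 0≤b = begin
  t * ℕtoℚ ∣ I ∣                               ≡⟨ cong (t *_) (card≡Σχ I) ⟩
  t * Σℚ k (χ I)                               ≡⟨ Σℚ-*ˡ k t (χ I) ⟨
  Σℚ k (λ i → t * χ I i)                       ≤⟨ Σℚ-mono-≤ k pointwise ⟩
  Σℚ k (λ i → t * χ Iₜ i + b i)                 ≡⟨ Σℚ-+ k _ b ⟩
  Σℚ k (λ i → t * χ Iₜ i) + Σℚ k b              ≡⟨ cong (_+ Σℚ k b) (trans (Σℚ-*ˡ k t (χ Iₜ)) (cong (t *_) (sym (card≡Σχ Iₜ)))) ⟩
  t * ℕtoℚ ∣ Iₜ ∣ + Σℚ k b                      ∎
  where
  open ℚP.≤-Reasoning
  Iₜ = I ∩ atMost b t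
  pointwise : ∀ i → t * χ I i ≤ t * χ Iₜ i + b i
  pointwise i = subst (λ x → t * χ I i ≤ t * x + b i) (sym χIₜ) (by-cases (lookup I i) (b i ℚP.≤? t))
    where
    χIₜ : χ Iₜ i ≡ χᵇ (lookup I i ∧ does (b i ℚP.≤? t))
    χIₜ = cong χᵇ (trans (lookup-zipWith _∧_ i I (atMost b t)) (cong (lookup I i ∧_) (lookup∘tabulate _ i)))
    by-cases : ∀ β (bi≤?t : Dec (b i ≤ t)) → t * χᵇ β ≤ t * χᵇ (β ∧ does bi≤?t) + b i
    by-cases false _          = ℚP.≤-trans (ℚP.≤-reflexive (sym (ℚP.+-identityʳ (t * 0ℚ)))) (ℚP.+-monoʳ-≤ (t * 0ℚ) (0≤b i))
    by-cases true  (yes _)    = ℚP.≤-trans (ℚP.≤-reflexive (sym (ℚP.+-identityʳ (t * 1ℚ)))) (ℚP.+-monoʳ-≤ (t * 1ℚ) (0≤b i))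
    by-cases true  (no bi≰t) = begin
      t * 1ℚ         ≡⟨ ℚP.*-identityʳ t ⟩
      t              ≤⟨ ℚP.<⇒≤ (ℚP.≰⇒> bi≰t) ⟩
      b i            ≡⟨ ℚP.+-identityˡ (b i) ⟨
      0ℚ + b i       ≡⟨ cong (_+ b i) (ℚP.*-zeroʳ t) ⟨
      t * 0ℚ + b i   ∎

trace∂≤boundaryIn : ∀ {n} (G : WGraph n) {A A′ X : Subset n} → A′ ⊆ A → trace∂ G A′ X ≤ boundaryIn G A X
trace∂≤boundaryIn G {A} {A′} {X} A′⊆A = wBetween-mono G (p∩q⊆p X A′) outside
  where
  outside : A′ ─ X ∩ A′ ⊆ A ─ X
  outside v∈ = x∈p∧x∉q⇒x∈p─q (A′⊆A (p─q⊆p A′ _ v∈))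
    λ v∈X → x∈p─q⇒x∉q A′ (X ∩ A′) v∈ (x∈p∩q⁺ (v∈X , p─q⊆p A′ _ v∈))

crossing⇒wParts≤ : ∀ {n k c} (G : WGraph n) {U : Subset n} (P : Fin k → Subset n) →
  (∀ i → Nonempty (P i)) → (∀ i → P i ⊆ U) → wParts G P + c * χ≠∅ U ≤ c * ℕtoℚ k →
  wParts G P ≤ c * ℕtoℚ (k ∸ 1)
crossing⇒wParts≤ {k = zero}  {c} G P _ _ _ = ℚP.≤-reflexive (sym (ℚP.*-zeroʳ c))
crossing⇒wParts≤ {k = suc k} {c} G {U} P P≢∅ P⊆U crossing = +-cancelʳ-≤ _ _ c (begin
  wParts G P + c                ≡⟨ cong (wParts G P +_) (trans (sym (ℚP.*-identityʳ c)) (cong (c *_) (sym (χ≠∅-yes U≢∅)))) ⟩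
  wParts G P + c * χ≠∅ U        ≤⟨ crossing ⟩
  c * ℕtoℚ (1 ℕ.+ k)            ≡⟨ cong (c *_) (ℕtoℚ-+ 1 k) ⟩
  c * (1ℚ + ℕtoℚ k)             ≡⟨ solve 2 (λ c m → c :* (con 1ℚ :+ m) := c :* m :+ c) refl c (ℕtoℚ k) ⟩
  c * ℕtoℚ k + c                ∎)
  where
  open ℚP.≤-Reasoning
  U≢∅ : Nonempty U
  U≢∅ = proj₁ (P≢∅ zero) , P⊆U zero (proj₂ (P≢∅ zero))

half-minus-five : ∀ {λ̃ nI nJ} → 0ℚ < λ̃ →
  (c0·4 * λ̃) * nI ≤ (c0·4 * λ̃) * nJ + (c1·01 * λ̃ + (c0·1 * λ̃ + c0·1 * λ̃) * nI) →
  c1/2 * nI - ℕtoℚ 5 ≤ nJ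
half-minus-five {λ̃} {nI} {nJ} 0<λ̃ counted = ℚP.*-cancelˡ-≤-pos t {{positive 0<t}} (begin
  t * (c1/2 * nI - ℕtoℚ 5)
    ≡⟨ solve 2 (λ λ̃ nI → (con c0·4 :* λ̃) :* (con c1/2 :* nI :- con (ℕtoℚ 5))
                        := (con c0·4 :* λ̃) :* nI :- (con c0·1 :* λ̃ :+ con c0·1 :* λ̃) :* nI :- con (ℕtoℚ 2) :* λ̃)
               refl λ̃ nI ⟩
  t * nI - twoC * nI - ℕtoℚ 2 * λ̃
    ≤⟨ ℚP.+-monoˡ-≤ (ℚ.- (ℕtoℚ 2 * λ̃)) (ℚP.+-monoˡ-≤ (ℚ.- (twoC * nI)) counted) ⟩
  t * nJ + (c1·01 * λ̃ + twoC * nI) - twoC * nI - ℕtoℚ 2 * λ̃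
    ≡⟨ solve 3 (λ λ̃ nI nJ → (con c0·4 :* λ̃) :* nJ :+ (con c1·01 :* λ̃ :+ (con c0·1 :* λ̃ :+ con c0·1 :* λ̃) :* nI)
                             :- (con c0·1 :* λ̃ :+ con c0·1 :* λ̃) :* nI :- con (ℕtoℚ 2) :* λ̃
                           := (con c0·4 :* λ̃) :* nJ :+ con (c1·01 - ℕtoℚ 2) :* λ̃)
               refl λ̃ nI nJ ⟩
  t * nJ + (c1·01 - ℕtoℚ 2) * λ̃
    ≤⟨ ℚP.+-monoʳ-≤ (t * nJ) slack≤0 ⟩
  t * nJ + 0ℚ
    ≡⟨ ℚP.+-identityʳ (t * nJ) ⟩
  t * nJ
    ∎)
  where
  open ℚP.≤-Reasoning
  t = c0·4 * λ̃
  twoC = c0·1 * λ̃ + c0·1 * λ̃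
  0<t : 0ℚ < t
  0<t = subst (_< t) (ℚP.*-zeroʳ c0·4) (ℚP.*-monoʳ-<-pos c0·4 0<λ̃)
  slack≤0 : (c1·01 - ℕtoℚ 2) * λ̃ ≤ 0ℚ
  slack≤0 = subst ((c1·01 - ℕtoℚ 2) * λ̃ ≤_) (ℚP.*-zeroˡ λ̃)
    (ℚP.*-monoʳ-≤-nonNeg λ̃ {{nonNegative (ℚP.<⇒≤ 0<λ̃)}} (from-yes (c1·01 - ℕtoℚ 2 ℚP.≤? 0ℚ)))

*-nonneg : ∀ {p q} → 0ℚ ≤ p → 0ℚ ≤ q → 0ℚ ≤ p * q
*-nonneg {p} {q} 0≤p 0≤q =
  ℚP.nonNegative⁻¹ (p * q) {{ℚP.nonNeg*nonNeg⇒nonNeg p {{nonNegative 0≤p}} q {{nonNegative 0≤q}}}}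

module _ {n : ℕ} (G : WGraph n) {λ̃ : ℚ} (0<λ̃ : 0ℚ < λ̃) where

  0≤λ̃/10 : 0ℚ ≤ c0·1 * λ̃
  0≤λ̃/10 = ℚP.<⇒≤ (subst (_< c0·1 * λ̃) (ℚP.*-zeroʳ c0·1) (ℚP.*-monoʳ-<-pos c0·1 0<λ̃))

  light-traces : ∀ {A U} (𝒞 : Clustering G (c0·1 * λ̃) U) → boundaryIn G A U ≤ c1·01 * λ̃ →
    let open Clustering 𝒞 in
    ∀ (A′ : Subset n) → A′ ⊆ A → ∀ (I : Subset k) → (∀ i → (i ∈ I) ⇔ Nonempty (P i ∩ A′)) →
    ∃[ J ] (J ⊆ I) × (c1/2 * ℕtoℚ ∣ I ∣ - ℕtoℚ 5 ≤ ℕtoℚ ∣ J ∣) ×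
           (∀ i → i ∈ J → boundaryIn G A′ (P i ∩ A′) ≤ c0·4 * λ̃)
  light-traces {A} {U} 𝒞 ∂U≤ A′ A′⊆A I I⇔ =
    I ∩ atMost b t , p∩q⊆p I _ , half-minus-five 0<λ̃ counted , λ i i∈J → ∈atMost⇒≤ {b = b} (p∩q⊆q I (atMost b t) i∈J)
    where
    open Clustering 𝒞
    open ℚP.≤-Reasoning
    c t : ℚ
    c = c0·1 * λ̃
    t = c0·4 * λ̃
    b : Fin k → ℚ
    b i = trace∂ G A′ (P i)
    χ≠∅≡χI : ∀ i → χ≠∅ (P i ∩ A′) ≡ χ I i
    χ≠∅≡χI i with lookup I i in Ii
    ... | true  = χ≠∅-yes (Equivalence.to (I⇔ i) (lookup⇒[]= i I Ii))
    ... | false = χ≠∅-no λ Pi∩A′≢∅ → contradiction (trans (sym ([]=⇒lookup (Equivalence.from (I⇔ i) Pi∩A′≢∅))) Ii) λ ()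
    0≤c+c : 0ℚ ≤ c + c
    0≤c+c = ℚP.+-mono-≤ 0≤λ̃/10 0≤λ̃/10
    Σb≤ : Σℚ k b ≤ c1·01 * λ̃ + (c + c) * ℕtoℚ ∣ I ∣
    Σb≤ = begin
      Σℚ k b                                              ≡⟨ ℚP.+-identityʳ (Σℚ k b) ⟨
      Σℚ k b + 0ℚ                                         ≤⟨ ℚP.+-monoʳ-≤ (Σℚ k b) (*-nonneg 0≤c+c (χ≠∅-nonneg (U ∩ A′))) ⟩
      Σℚ k b + (c + c) * χ≠∅ (U ∩ A′)                     ≤⟨ boundary A′ ⟩
      trace∂ G A′ U + (c + c) * Σℚ k (λ i → χ≠∅ (P i ∩ A′))
                                                          ≡⟨ cong (λ N → trace∂ G A′ U + (c + c) * N)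
                                                                  (trans (Σℚ-cong k χ≠∅≡χI) (sym (card≡Σχ I))) ⟩
      trace∂ G A′ U + (c + c) * ℕtoℚ ∣ I ∣               ≤⟨ ℚP.+-monoˡ-≤ ((c + c) * ℕtoℚ ∣ I ∣)
                                                                      (ℚP.≤-trans (trace∂≤boundaryIn G A′⊆A) ∂U≤) ⟩
      c1·01 * λ̃ + (c + c) * ℕtoℚ ∣ I ∣                   ∎
    counted : t * ℕtoℚ ∣ I ∣ ≤ t * ℕtoℚ ∣ I ∩ atMost b t ∣ + (c1·01 * λ̃ + (c + c) * ℕtoℚ ∣ I ∣)
    counted = ℚP.≤-trans (markov I b t (λ i → wBetween-nonneg G (P i ∩ A′) (A′ ─ P i ∩ A′)))
                         (ℚP.+-monoʳ-≤ (t * ℕtoℚ ∣ I ∩ atMost b t ∣) Σb≤)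

  wParts-bound : ∀ {U} (𝒞 : Clustering G (c0·1 * λ̃) U) →
    let open Clustering 𝒞 in wParts G P ≤ c0·1 * ℕtoℚ (k ∸ 1) * λ̃
  wParts-bound 𝒞 =
    subst (wParts G P ≤_) (solve 2 (λ λ̃ m → con c0·1 :* λ̃ :* m := con c0·1 :* m :* λ̃) refl λ̃ (ℕtoℚ (k ∸ 1)))
          (crossing⇒wParts≤ {c = c0·1 * λ̃} G P (proj₁ partition) (proj₁ (proj₂ (proj₂ partition))) crossing)
    where open Clustering 𝒞

  light-parts : ∀ {A U} (𝒞 : Clustering G (c0·1 * λ̃) U) → U ⊆ A → boundaryIn G A U ≤ c1·01 * λ̃ →
    let open Clustering 𝒞 in
    ∃[ J ] (c1/2 * ℕtoℚ k - ℕtoℚ 5 ≤ ℕtoℚ ∣ J ∣) × (∀ i → i ∈ J → boundaryIn G A (P i) ≤ c0·4 * λ̃)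
  light-parts {A} {U} 𝒞 U⊆A ∂U≤ = restrict (light-traces {A} {U} 𝒞 ∂U≤ A id ⊤ every-part-meets-A)
    where
    open Clustering 𝒞
    P∩A≡P : ∀ i → P i ∩ A ≡ P i
    P∩A≡P i = ⊆-antisym (p∩q⊆p (P i) A) λ v∈Pi → x∈p∩q⁺ (v∈Pi , U⊆A (proj₁ (proj₂ (proj₂ partition)) i v∈Pi))
    every-part-meets-A : ∀ i → (i ∈ ⊤) ⇔ Nonempty (P i ∩ A)
    every-part-meets-A i = mk⇔ (λ _ → subst Nonempty (sym (P∩A≡P i)) (proj₁ partition i)) (λ _ → ∈⊤)
    restrict : ∃[ J ] (J ⊆ ⊤) × (c1/2 * ℕtoℚ ∣ ⊤ {k} ∣ - ℕtoℚ 5 ≤ ℕtoℚ ∣ J ∣) ×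
                      (∀ i → i ∈ J → boundaryIn G A (P i ∩ A) ≤ c0·4 * λ̃) →
               ∃[ J ] (c1/2 * ℕtoℚ k - ℕtoℚ 5 ≤ ℕtoℚ ∣ J ∣) × (∀ i → i ∈ J → boundaryIn G A (P i) ≤ c0·4 * λ̃)
    restrict (J , _ , counted , light) =
      J , subst (λ m → c1/2 * ℕtoℚ m - ℕtoℚ 5 ≤ ℕtoℚ ∣ J ∣) (∣⊤∣≡n k) counted ,
      λ i i∈J → subst (λ X → boundaryIn G A X ≤ c0·4 * λ̃) (P∩A≡P i) (light i i∈J)

mainTheorem9 :
    ∀ {n : ℕ} (G : WGraph n) (λ̃ τ : ℚ) →
    0ℚ < λ̃ →
    0ℚ < τ →
    MinCutAtLeast G ⊤ (λ̃ * c1/1·01) →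
    ∀ (A U : Subset n) → U ⊆ A →
    boundaryIn G A U ≤ c1·01 * λ̃ →
    vol G U ≤ s₀ λ̃ τ →
    ∃[ k ] Σ (Fin k → Subset n) λ P →
      IsPartition U P ×
      (∀ i → MinCutAtLeast G (P i) (c0·1 * λ̃)) ×
      (∃[ J ] (c1/2 * ℕtoℚ k - ℕtoℚ 5 ≤ ℕtoℚ ∣ J ∣) ×
              (∀ i → i ∈ J → boundaryIn G A (P i) ≤ c0·4 * λ̃)) ×
      (wParts G P ≤ c0·1 * ℕtoℚ (k ∸ 1) * λ̃) ×
      (∀ (A′ : Subset n) → A′ ⊆ A → ∀ (I : Subset k) →
        (∀ i → (i ∈ I) ⇔ Nonempty (P i ∩ A′)) →
        ∃[ J ] (J ⊆ I) × (c1/2 * ℕtoℚ ∣ I ∣ - ℕtoℚ 5 ≤ ℕtoℚ ∣ J ∣) ×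
               (∀ i → i ∈ J → boundaryIn G A′ (P i ∩ A′) ≤ c0·4 * λ̃))
mainTheorem9 G λ̃ τ 0<λ̃ _ _ A U U⊆A ∂U≤ _ =
  k , P , partition , minCut , light-parts G 0<λ̃ 𝒞 U⊆A ∂U≤ , wParts-bound G 0<λ̃ 𝒞 , light-traces G 0<λ̃ 𝒞 ∂U≤
  where
  𝒞 : Clustering G (c0·1 * λ̃) U
  𝒞 = clustering G (0≤λ̃/10 G 0<λ̃) U
  open Clustering 𝒞
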